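{- Let $(T_1,r_1)$ and $(T_2,r_2)$ be rooted trees with $V(T_1)\cap V(T_2)=\emptyset$, let $(T,r_1)=(T_1,r_1)\circ(T_2,r_2)$, let $f:V(T)\to\{0,1,2\}$, and let $f_1=f|_{V(T_1)}$, $f_2=f|_{V(T_2)}$. Then $(T,f,r_1)\in B$ if and only if $(T_1,f_1,r_1)\in B$ and $(T_2,f_2,r_2)\in C\cup D$.
   Context: For a graph (or forest) $G$, an independent Roman $\{2\}$-dominating function (IR2DF) is a function $f:V(G)\to\{0,1,2\}$ such that every vertex $v$ with $f(v)=0$ satisfies $\sum_{u\in N(v)}f(u)\ge 2$ and the set $\{v: f(v)>0\}$ is independent; the empty function on the empty graph is regarded as an IR2DF. A rooted tree is a pair $(T,r)$ with $T$ a tree and $r\in V(T)$. For rooted trees with disjoint vertex sets, the composition $(T_1,r_1)\circ(T_2,r_2)=(T,r_1)$ has $V(T)=V(T_1)\cup V(T_2)$ and $E(T)=E(T_1)\cup E(T_2)\cup\{r_1r_2\}$. For a rooted tree $(T,r)$ and $f:V(T)\to\{0,1,2\}$, let $IR2DF(T)$ be the set of IR2DFs of $T$, $IR2DF_r(T)=\{f: f\notin IR2DF(T)$ and $f|_{V(T)\setminus\{r\}}\in IR2DF(T-r)\}$, and $f(N[r])=\sum_{u\in N_T[r]}f(u)$. Define the classes of triples: $A=\{(T,f,r): f\in IR2DF(T), f(r)=2\}$; $B=\{(T,f,r): f\in IR2DF(T), f(r)=1\}$; $C=\{(T,f,r): f\in IR2DF(T), f(r)=0\}$; $D=\{(T,f,r):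 f\in IR2DF_r(T), f(N[r])=1\}$; $E=\{(T,f,r): f\in IR2DF_r(T), f(N[r])=0\}$. -}

module Defs where

open import Data.Nat using (ℕ; zero; suc; _+_; _≤_)
open import Data.Fin using (Fin; toℕ; splitAt; _↑ˡ_; _↑ʳ_)
open import Data.Fin.Properties using (_≟_)
open import Data.Bool using (Bool; true; false; if_then_else_; _∧_; not)
open import Data.List using (List; []; _∷_; _++_; take; length; map; allFin)
open import Data.Nat.ListAction using (sum)
open import Data.List.Relation.Unary.Unique.Propositional using (Unique)
open import Data.Sum using (_⊎_; inj₁; inj₂)
open import Data.Product using (_×_; Σ; ∃)
open import Data.Unit using (⊤)
open import Relation.Nullary using (¬_)
open import Relation.Nullary.Decidable using (⌊_⌋)
open import Relation.Binary.PropositionalEquality using (_≡_; _≢_)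

Adj : ℕ → Set
Adj n = Fin n → Fin n → Bool

Lab : ℕ → Set
Lab n = Fin n → Fin 3

data Walk {n : ℕ} (A : Adj n) : Fin n → Fin n → Set where
  here : ∀ {u} → Walk A u u
  step : ∀ {u w v} → A u w ≡ true → Walk A w v → Walk A u v

Chain : {n : ℕ} → Adj n → List (Fin n) → Set
Chain A [] = ⊤
Chain A (x ∷ []) = ⊤
Chain A (x ∷ y ∷ xs) = (A x y ≡ true) × Chain A (y ∷ xs)

-- A cycle: at least 3 distinct vertices v0 … vk, consecutive ones adjacent, vk adjacent to v0.
HasCycle : {n : ℕ} → Adj n → Set
HasCycle {n} A = Σ (List (Fin n)) λ vs → (3 ≤ length vs) × Unique vs × Chain A (vs ++ take 1 vs)

-- A tree: simple (symmetric, irreflexive), connected, acyclic graph.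
-- (Nonemptiness is guaranteed for rooted trees by the root.)
IsTree : {n : ℕ} → Adj n → Set
IsTree {n} A =
  (∀ u v → A u v ≡ A v u) ×
  (∀ v → A v v ≡ false) ×
  (∀ u v → Walk A u v) ×
  ¬ HasCycle A

nsumIn : {n : ℕ} → Adj n → (Fin n → Bool) → Lab n → Fin n → ℕ
nsumIn {n} A S f v =
  sum (map (λ u → if S u ∧ A v u then toℕ (f u) else 0) (allFin n))

IR2DFOn : {n : ℕ} → Adj n → (Fin n → Bool) → Lab n → Set
IR2DFOn {n} A S f =
  (∀ v → S v ≡ true → toℕ (f v) ≡ 0 → 2 ≤ nsumIn A S f v) ×
  (∀ u v → S u ≡ true → S v ≡ true → A u v ≡ true → (toℕ (f u) ≡ 0 ⊎ toℕ (f v) ≡ 0))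

everything : {n : ℕ} → Fin n → Bool
everything _ = true

IR2DF : {n : ℕ} → Adj n → Lab n → Set
IR2DF A f = IR2DFOn A everything f

allBut : {n : ℕ} → Fin n → Fin n → Bool
allBut r u = not ⌊ u ≟ r ⌋

IR2DFr : {n : ℕ} → Adj n → Lab n → Fin n → Set
IR2DFr A f r = ¬ IR2DF A f × IR2DFOn A (allBut r) (f)

closedNbhdSum : {n : ℕ} → Adj n → Lab n → Fin n → ℕ
closedNbhdSum A f r = toℕ (f r) + nsumIn A everything f r

ClassB : {n : ℕ} → Adj n → Lab n → Fin n → Set
ClassB A f r = IR2DF A f × toℕ (f r) ≡ 1

ClassC : {n : ℕ} → Adj n → Lab n → Fin n → Set
ClassC A f r = IR2DF A f × toℕ (f r) ≡ 0

ClassD : {n : ℕ} → Adj n → Lab n → Fin n → Set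
ClassD A f r = IR2DFr A f r × closedNbhdSum A f r ≡ 1

-- Composition (T1,r1) ∘ (T2,r2): vertex set Fin (n1 + n2), with V(T1) embedded as
-- i ↑ˡ n2 and V(T2) as n1 ↑ʳ j (disjoint), plus the edge r1 r2.
compose : {n₁ n₂ : ℕ} → Adj n₁ → Fin n₁ → Adj n₂ → Fin n₂ → Adj (n₁ + n₂)
compose {n₁} A₁ r₁ A₂ r₂ i j with splitAt n₁ i | splitAt n₁ j
... | inj₁ a | inj₁ b = A₁ a b
... | inj₂ a | inj₂ b = A₂ a b
... | inj₁ a | inj₂ b = ⌊ a ≟ r₁ ⌋ ∧ ⌊ b ≟ r₂ ⌋
... | inj₂ a | inj₁ b = ⌊ b ≟ r₁ ⌋ ∧ ⌊ a ≟ r₂ ⌋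

{-# OPTIONS --safe #-}
-- The only edge between the two parts is r₁r₂, and f(r₁) = 1 forces f(r₂) = 0. So in T a
-- vertex of T₁ other than r₁ and a vertex of T₂ other than r₂ see exactly the weight they see
-- in their own tree, while r₂ sees one unit more. Hence (T, f, r₁) ∈ B iff (T₁, f₁, r₁) ∈ B and
-- f₂ is independent, vanishes at r₂, dominates T₂ − r₂ and puts weight ≥ 1 on N(r₂); weight ≥ 2
-- there is class C, weight exactly 1 is class D. Conversely, class D with f₂(r₂) = 1 would leave
-- N(r₂) weightless and make f₂ an IR2DF, which D excludes.
module Submission where

open import Defs
open import Data.Bool using (Bool; true; false; if_then_else_; _∧_)
open import Data.Bool.Properties using (∧-comm)
open import Data.Fin using (Fin; toℕ; splitAt; join; _↑ˡ_; _↑ʳ_)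
import Data.Fin as Fin
open import Data.Fin.Properties using (_≟_; suc-injective; splitAt-↑ˡ; splitAt-↑ʳ; join-splitAt)
open import Data.List using (map; tabulate; allFin)
import Data.Nat.ListAction as List
import Data.Nat.Properties as ℕₚ
open import Data.Nat using (ℕ; zero; suc; _+_; _≤_; z≤n; s≤s; s≤s⁻¹; _≤?_)
open import Data.Nat.Properties
  using (+-0-monoid; +-assoc; +-identityʳ; +-mono-≤; ≤-refl; ≤-reflexive; ≤-trans; ≤-antisym; m≤m+n; m≤n+m; ≰⇒>; n≤0⇒n≡0)
open import Algebra.Properties.Monoid.Sum +-0-monoid
  using (sum; sum-cong-≗; sum-replicate-zero)
open import Data.Product using (_×_; _,_; proj₁; proj₂)
open import Data.Product.Function.NonDependent.Propositional using (_×-⇔_)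
open import Data.Sum using (_⊎_; inj₁; inj₂; [_,_]; swap; fromInj₂)
open import Data.Empty using (⊥-elim)
open import Function using (_∘_; _⇔_; mk⇔; Equivalence)
import Function.Properties.Equivalence as ⇔
open import Relation.Nullary using (¬_; yes; no)
open import Relation.Nullary.Decidable using (⌊_⌋)
open import Relation.Binary.PropositionalEquality
  using (_≡_; _≢_; refl; sym; trans; cong; cong₂; subst; subst₂; module ≡-Reasoning)

open Equivalence using (to; from)

sum-tabulate : ∀ {m} n (h : Fin n → Fin m) (g : Fin m → ℕ) →
               List.sum (map g (tabulate h)) ≡ sum (g ∘ h)
sum-tabulate zero    h g = refl
sum-tabulate (suc n) h g = cong (g (h Fin.zero) +_) (sum-tabulate n (h ∘ Fin.suc) g)

sum-allFin : ∀ n (g : Fin n → ℕ) → List.sum (map g (allFin n)) ≡ sum g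
sum-allFin n = sum-tabulate n (λ i → i)

sum-↑ : ∀ m n (g : Fin (m + n) → ℕ) → sum g ≡ sum (g ∘ (_↑ˡ n)) + sum (g ∘ (m ↑ʳ_))
sum-↑ zero    n g = refl
sum-↑ (suc m) n g = begin
  g Fin.zero + sum (g ∘ Fin.suc)
    ≡⟨ cong (g Fin.zero +_) (sum-↑ m n (g ∘ Fin.suc)) ⟩
  g Fin.zero + (sum (g ∘ Fin.suc ∘ (_↑ˡ n)) + sum (g ∘ Fin.suc ∘ (m ↑ʳ_)))
    ≡⟨ +-assoc (g Fin.zero) _ _ ⟨
  sum (g ∘ (_↑ˡ n)) + sum (g ∘ (suc m ↑ʳ_)) ∎
  where open ≡-Reasoning

sum-single : ∀ {n} (g : Fin n → ℕ) (r : Fin n) → (∀ j → j ≢ r → g j ≡ 0) → sum g ≡ g r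
sum-single {suc n} g Fin.zero    off = begin
  g Fin.zero + sum (g ∘ Fin.suc) ≡⟨ cong (g Fin.zero +_) (sum-cong-≗ (λ j → off (Fin.suc j) λ ())) ⟩
  g Fin.zero + sum {n} (λ _ → 0) ≡⟨ cong (g Fin.zero +_) (sum-replicate-zero n) ⟩
  g Fin.zero + 0                 ≡⟨ +-identityʳ _ ⟩
  g Fin.zero                     ∎
  where open ≡-Reasoning
sum-single {suc n} g (Fin.suc r) off =
  cong₂ _+_ (off Fin.zero λ ()) (sum-single (g ∘ Fin.suc) r (λ j j≢r → off (Fin.suc j) (j≢r ∘ suc-injective)))

sum-guarded-single : ∀ {n} (b : Bool) (r : Fin n) (h : Fin n → ℕ) →
                     sum (λ j → if b ∧ ⌊ j ≟ r ⌋ then h j else 0) ≡ (if b then h r else 0)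
sum-guarded-single {n} false r h = sum-replicate-zero n
sum-guarded-single     true  r h = trans (sum-single _ r off) on
  where
  on : (if ⌊ r ≟ r ⌋ then h r else 0) ≡ h r
  on with r ≟ r
  ... | yes _   = refl
  ... | no  r≢r = ⊥-elim (r≢r refl)
  off : ∀ j → j ≢ r → (if ⌊ j ≟ r ⌋ then h j else 0) ≡ 0
  off j j≢r with j ≟ r
  ... | yes j≡r = ⊥-elim (j≢r j≡r)
  ... | no  _   = refl

sum-mono : ∀ {n} {g h : Fin n → ℕ} → (∀ j → g j ≤ h j) → sum g ≤ sum h
sum-mono {zero}  g≤h = z≤n
sum-mono {suc n} g≤h = +-mono-≤ (g≤h Fin.zero) (sum-mono (g≤h ∘ Fin.suc))

≤-sum : ∀ {n} (g : Fin n → ℕ) (j : Fin n) → g j ≤ sum g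
≤-sum g Fin.zero    = m≤m+n _ _
≤-sum g (Fin.suc j) = ≤-trans (≤-sum (g ∘ Fin.suc) j) (m≤n+m _ _)

↑-elim : ∀ {m n} (P : Fin (m + n) → Set) →
         (∀ i → P (i ↑ˡ n)) → (∀ j → P (m ↑ʳ j)) → ∀ k → P k
↑-elim {m} {n} P left right k =
  subst P (join-splitAt m n k) ([_,_] {C = P ∘ join m n} left right (splitAt m k))

nsum : ∀ {n} → Adj n → Lab n → Fin n → ℕ
nsum A = nsumIn A everything

Dominated : ∀ {n} → Adj n → Lab n → Fin n → Set
Dominated A f v = toℕ (f v) ≡ 0 → 2 ≤ nsum A f v

Independent : ∀ {n} → Adj n → Lab n → Set
Independent A f = ∀ u v → A u v ≡ true → toℕ (f u) ≡ 0 ⊎ toℕ (f v) ≡ 0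

IR2DF⇔ : ∀ {n} {A : Adj n} {f : Lab n} →
         IR2DF A f ⇔ ((∀ v → Dominated A f v) × Independent A f)
IR2DF⇔ = mk⇔ (λ (dom , ind) → (λ v → dom v refl) , (λ u v → ind u v refl refl))
             (λ (dom , ind) → (λ v _ → dom v) , (λ u v _ _ → ind u v))

nsumIn-sum : ∀ {n} (A : Adj n) (S : Fin n → Bool) (f : Lab n) (v : Fin n) →
             nsumIn A S f v ≡ sum (λ u → if S u ∧ A v u then toℕ (f u) else 0)
nsumIn-sum {n} A S f v = sum-allFin n _

neighbour-zero : ∀ {n} (A : Adj n) (f : Lab n) {v u : Fin n} →
                 nsum A f v ≡ 0 → A v u ≡ true → toℕ (f u) ≡ 0
neighbour-zero A f {v} {u} s≡0 vu = n≤0⇒n≡0 (begin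
  toℕ (f u)                                             ≡⟨ cong (λ b → if b then toℕ (f u) else 0) vu ⟨
  (if A v u then toℕ (f u) else 0)                      ≤⟨ ≤-sum _ u ⟩
  sum (λ w → if A v w then toℕ (f w) else 0)            ≡⟨ nsumIn-sum A everything f v ⟨
  nsum A f v                                            ≡⟨ s≡0 ⟩
  0                                                     ∎)
  where open ℕₚ.≤-Reasoning

allBut⇒≢ : ∀ {n} {r v : Fin n} → allBut r v ≡ true → v ≢ r
allBut⇒≢ {r = r} {v} ab v≡r with v ≟ r
allBut⇒≢ () _   | yes _
allBut⇒≢ _  v≡r | no v≢r = v≢r v≡r

≢⇒allBut : ∀ {n} {r v : Fin n} → v ≢ r → allBut r v ≡ true
≢⇒allBut {r = r} {v} v≢r with v ≟ r
... | yes v≡r = ⊥-elim (v≢r v≡r)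
... | no  _   = refl

nsumIn-allBut-≤ : ∀ {n} (A : Adj n) (f : Lab n) (r v : Fin n) → nsumIn A (allBut r) f v ≤ nsum A f v
nsumIn-allBut-≤ A f r v =
  subst₂ _≤_ (sym (nsumIn-sum A (allBut r) f v)) (sym (nsumIn-sum A everything f v))
    (sum-mono λ u → guard-≤ (allBut r u) (A v u) (toℕ (f u)))
  where
  guard-≤ : ∀ b c k → (if b ∧ c then k else 0) ≤ (if c then k else 0)
  guard-≤ true  c     k = ≤-refl
  guard-≤ false true  k = z≤n
  guard-≤ false false k = z≤n

nsumIn-allBut : ∀ {n} (A : Adj n) (f : Lab n) (r v : Fin n) →
                toℕ (f r) ≡ 0 → nsumIn A (allBut r) f v ≡ nsum A f v
nsumIn-allBut A f r v fr≡0 = begin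
  nsumIn A (allBut r) f v                                 ≡⟨ nsumIn-sum A (allBut r) f v ⟩
  sum (λ u → if allBut r u ∧ A v u then toℕ (f u) else 0) ≡⟨ sum-cong-≗ pointwise ⟩
  sum (λ u → if A v u then toℕ (f u) else 0)              ≡⟨ nsumIn-sum A everything f v ⟨
  nsum A f v                                              ∎
  where
  open ≡-Reasoning
  pointwise : ∀ u → (if allBut r u ∧ A v u then toℕ (f u) else 0) ≡ (if A v u then toℕ (f u) else 0)
  pointwise u with u ≟ r
  ... | no  _    = refl
  ... | yes refl with A v u
  ...   | true  = sym fr≡0
  ...   | false = refl

independent-allBut : ∀ {n} {A : Adj n} {f : Lab n} {r : Fin n} → (∀ u v → A u v ≡ A v u) →
                     (∀ v → A r v ≡ true → toℕ (f r) ≡ 0 ⊎ toℕ (f v) ≡ 0) →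
                     (∀ u v → allBut r u ≡ true → allBut r v ≡ true → A u v ≡ true →
                        toℕ (f u) ≡ 0 ⊎ toℕ (f v) ≡ 0) →
                     Independent A f
independent-allBut {r = r} symm at-r ind u v uv with u ≟ r | v ≟ r
... | yes refl | _        = at-r v uv
... | no _     | yes refl = swap (at-r u (trans (symm r u) uv))
... | no u≢r   | no v≢r   = ind u v (≢⇒allBut u≢r) (≢⇒allBut v≢r) uv

dominated-allBut : ∀ {n} {A : Adj n} {f : Lab n} {r : Fin n} →
                   IR2DFOn A (allBut r) f → ∀ v → v ≢ r → Dominated A f v
dominated-allBut {A = A} {f} {r} (dom , _) v v≢r fv≡0 =
  ≤-trans (dom v (≢⇒allBut v≢r) fv≡0) (nsumIn-allBut-≤ A f r v)

m+n≡1 : ∀ m {n} → m + n ≡ 1 → (m ≡ 0 × n ≡ 1) ⊎ (m ≡ 1 × n ≡ 0)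
m+n≡1 zero          eq = inj₁ (refl , eq)
m+n≡1 (suc zero)    eq = inj₂ (refl , ℕₚ.suc-injective eq)
m+n≡1 (suc (suc m)) ()

≡1⇒≢0 : ∀ {k} → k ≡ 1 → k ≢ 0
≡1⇒≢0 refl ()

-- The requirement on a subtree whose root r is joined to a vertex of weight 1:
-- that vertex forces f r = 0 and contributes exactly one unit to the weight around r.
record HangsFromWeight1 {n} (A : Adj n) (f : Lab n) (r : Fin n) : Set where
  field
    root-zero    : toℕ (f r) ≡ 0
    root-covered : 1 ≤ nsum A f r
    dominated    : ∀ v → v ≢ r → Dominated A f v
    independent  : Independent A f

module _ {n} {A : Adj n} {f : Lab n} {r : Fin n} where

  ClassC→HangsFromWeight1 : ClassC A f r → HangsFromWeight1 A f r
  ClassC→HangsFromWeight1 (ir , fr≡0) with to IR2DF⇔ ir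
  ... | dom , ind = record
    { root-zero    = fr≡0
    ; root-covered = ≤-trans (s≤s z≤n) (dom r fr≡0)
    ; dominated    = λ v _ → dom v
    ; independent  = ind
    }

  ClassD→HangsFromWeight1 : (∀ u v → A u v ≡ A v u) → ClassD A f r → HangsFromWeight1 A f r
  ClassD→HangsFromWeight1 symm ((not-ir , restricted) , N[r]≡1) with m+n≡1 (toℕ (f r)) N[r]≡1
  ... | inj₁ (fr≡0 , s≡1) = record
    { root-zero    = fr≡0
    ; root-covered = ≤-reflexive (sym s≡1)
    ; dominated    = dominated-allBut restricted
    ; independent  = independent-allBut symm (λ _ _ → inj₁ fr≡0) (proj₂ restricted)
    }
  ... | inj₂ (fr≡1 , s≡0) = ⊥-elim (not-ir (from IR2DF⇔ (dom , ind)))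
    where
    dom : ∀ v → Dominated A f v
    dom v with v ≟ r
    ... | yes refl = ⊥-elim ∘ ≡1⇒≢0 fr≡1
    ... | no  v≢r  = dominated-allBut restricted v v≢r
    ind : Independent A f
    ind = independent-allBut symm (λ _ rv → inj₂ (neighbour-zero A f s≡0 rv)) (proj₂ restricted)

  HangsFromWeight1→ClassC⊎ClassD : HangsFromWeight1 A f r → ClassC A f r ⊎ ClassD A f r
  HangsFromWeight1→ClassC⊎ClassD h with 2 ≤? nsum A f r
  ... | yes 2≤s = inj₁ (from IR2DF⇔ (dom , independent) , root-zero)
    where
    open HangsFromWeight1 h
    dom : ∀ v → Dominated A f v
    dom v with v ≟ r
    ... | yes refl = λ _ → 2≤s
    ... | no  v≢r  = dominated v v≢r
  ... | no 2≰s = inj₂ ((not-ir , restricted) , cong₂ _+_ root-zero s≡1)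
    where
    open HangsFromWeight1 h
    s≡1 : nsum A f r ≡ 1
    s≡1 = ≤-antisym (s≤s⁻¹ (≰⇒> 2≰s)) root-covered
    not-ir : ¬ IR2DF A f
    not-ir ir = 2≰s (proj₁ ir r refl root-zero)
    restricted : IR2DFOn A (allBut r) f
    restricted = (λ v ab fv≡0 → subst (2 ≤_) (sym (nsumIn-allBut A f r v root-zero))
                                             (dominated v (allBut⇒≢ ab) fv≡0))
               , (λ u v _ _ → independent u v)

  ClassC⊎ClassD⇔HangsFromWeight1 : (∀ u v → A u v ≡ A v u) →
                                   (ClassC A f r ⊎ ClassD A f r) ⇔ HangsFromWeight1 A f r
  ClassC⊎ClassD⇔HangsFromWeight1 symm =
    mk⇔ [ ClassC→HangsFromWeight1 , ClassD→HangsFromWeight1 symm ] HangsFromWeight1→ClassC⊎ClassD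

⌊≟⌋∧⌊≟⌋⇔ : ∀ {m n} {i r : Fin m} {j s : Fin n} → (⌊ i ≟ r ⌋ ∧ ⌊ j ≟ s ⌋ ≡ true) ⇔ (i ≡ r × j ≡ s)
⌊≟⌋∧⌊≟⌋⇔ {i = i} {r} {j} {s} with i ≟ r | j ≟ s
... | yes i≡r | yes j≡s = mk⇔ (λ _ → i≡r , j≡s) (λ _ → refl)
... | yes _   | no  j≢s = mk⇔ (λ ()) (λ (_ , j≡s) → ⊥-elim (j≢s j≡s))
... | no  i≢r | _       = mk⇔ (λ ()) (λ (i≡r , _) → ⊥-elim (i≢r i≡r))

→2≤-cong : ∀ {P : Set} {a b : ℕ} → a ≡ b → (P → 2 ≤ a) ⇔ (P → 2 ≤ b)
→2≤-cong a≡b = mk⇔ (λ d → subst (2 ≤_) a≡b ∘ d) (λ d → subst (2 ≤_) (sym a≡b) ∘ d)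

module Composition {n₁ n₂ : ℕ} (A₁ : Adj n₁) (r₁ : Fin n₁) (A₂ : Adj n₂) (r₂ : Fin n₂)
                   (f : Lab (n₁ + n₂)) where

  T : Adj (n₁ + n₂)
  T = compose A₁ r₁ A₂ r₂

  f₁ : Lab n₁
  f₁ i = f (i ↑ˡ n₂)

  f₂ : Lab n₂
  f₂ j = f (n₁ ↑ʳ j)

  edge-↑ˡ-↑ˡ : ∀ i k → T (i ↑ˡ n₂) (k ↑ˡ n₂) ≡ A₁ i k
  edge-↑ˡ-↑ˡ i k rewrite splitAt-↑ˡ n₁ i n₂ | splitAt-↑ˡ n₁ k n₂ = refl

  edge-↑ʳ-↑ʳ : ∀ j l → T (n₁ ↑ʳ j) (n₁ ↑ʳ l) ≡ A₂ j l
  edge-↑ʳ-↑ʳ j l rewrite splitAt-↑ʳ n₁ n₂ j | splitAt-↑ʳ n₁ n₂ l = refl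

  edge-↑ˡ-↑ʳ : ∀ i j → T (i ↑ˡ n₂) (n₁ ↑ʳ j) ≡ ⌊ i ≟ r₁ ⌋ ∧ ⌊ j ≟ r₂ ⌋
  edge-↑ˡ-↑ʳ i j rewrite splitAt-↑ˡ n₁ i n₂ | splitAt-↑ʳ n₁ n₂ j = refl

  edge-↑ʳ-↑ˡ : ∀ j i → T (n₁ ↑ʳ j) (i ↑ˡ n₂) ≡ ⌊ i ≟ r₁ ⌋ ∧ ⌊ j ≟ r₂ ⌋
  edge-↑ʳ-↑ˡ j i rewrite splitAt-↑ʳ n₁ n₂ j | splitAt-↑ˡ n₁ i n₂ = refl

  private
    weight-cong : ∀ {b c} k → b ≡ c → (if b then k else 0) ≡ (if c then k else 0)
    weight-cong k = cong (λ b → if b then k else 0)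

  nsum-↑ˡ : ∀ i → nsum T f (i ↑ˡ n₂) ≡ nsum A₁ f₁ i + (if ⌊ i ≟ r₁ ⌋ then toℕ (f₂ r₂) else 0)
  nsum-↑ˡ i = begin
    nsum T f (i ↑ˡ n₂)
      ≡⟨ nsumIn-sum T everything f (i ↑ˡ n₂) ⟩
    sum (λ u → if T (i ↑ˡ n₂) u then toℕ (f u) else 0)
      ≡⟨ sum-↑ n₁ n₂ _ ⟩
    sum (λ k → if T (i ↑ˡ n₂) (k ↑ˡ n₂) then toℕ (f₁ k) else 0)
      + sum (λ j → if T (i ↑ˡ n₂) (n₁ ↑ʳ j) then toℕ (f₂ j) else 0)
      ≡⟨ cong₂ _+_ (sum-cong-≗ λ k → weight-cong _ (edge-↑ˡ-↑ˡ i k))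
                   (sum-cong-≗ λ j → weight-cong _ (edge-↑ˡ-↑ʳ i j)) ⟩
    sum (λ k → if A₁ i k then toℕ (f₁ k) else 0)
      + sum (λ j → if ⌊ i ≟ r₁ ⌋ ∧ ⌊ j ≟ r₂ ⌋ then toℕ (f₂ j) else 0)
      ≡⟨ cong₂ _+_ (sym (nsumIn-sum A₁ everything f₁ i)) (sum-guarded-single ⌊ i ≟ r₁ ⌋ r₂ (toℕ ∘ f₂)) ⟩
    nsum A₁ f₁ i + (if ⌊ i ≟ r₁ ⌋ then toℕ (f₂ r₂) else 0) ∎
    where open ≡-Reasoning

  nsum-↑ʳ : ∀ j → nsum T f (n₁ ↑ʳ j) ≡ (if ⌊ j ≟ r₂ ⌋ then toℕ (f₁ r₁) else 0) + nsum A₂ f₂ j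
  nsum-↑ʳ j = begin
    nsum T f (n₁ ↑ʳ j)
      ≡⟨ nsumIn-sum T everything f (n₁ ↑ʳ j) ⟩
    sum (λ u → if T (n₁ ↑ʳ j) u then toℕ (f u) else 0)
      ≡⟨ sum-↑ n₁ n₂ _ ⟩
    sum (λ i → if T (n₁ ↑ʳ j) (i ↑ˡ n₂) then toℕ (f₁ i) else 0)
      + sum (λ l → if T (n₁ ↑ʳ j) (n₁ ↑ʳ l) then toℕ (f₂ l) else 0)
      ≡⟨ cong₂ _+_ (sum-cong-≗ λ i → weight-cong _ (trans (edge-↑ʳ-↑ˡ j i) (∧-comm ⌊ i ≟ r₁ ⌋ ⌊ j ≟ r₂ ⌋)))
                   (sum-cong-≗ λ l → weight-cong _ (edge-↑ʳ-↑ʳ j l)) ⟩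
    sum (λ i → if ⌊ j ≟ r₂ ⌋ ∧ ⌊ i ≟ r₁ ⌋ then toℕ (f₁ i) else 0)
      + sum (λ l → if A₂ j l then toℕ (f₂ l) else 0)
      ≡⟨ cong₂ _+_ (sum-guarded-single ⌊ j ≟ r₂ ⌋ r₁ (toℕ ∘ f₁)) (sym (nsumIn-sum A₂ everything f₂ j)) ⟩
    (if ⌊ j ≟ r₂ ⌋ then toℕ (f₁ r₁) else 0) + nsum A₂ f₂ j ∎
    where open ≡-Reasoning

  independent-compose : Independent T f ⇔
    (Independent A₁ f₁ × Independent A₂ f₂ × (toℕ (f₁ r₁) ≡ 0 ⊎ toℕ (f₂ r₂) ≡ 0))
  independent-compose = mk⇔ split join-parts
    where
    split : Independent T f → _
    split ind = (λ i k ik → ind _ _ (trans (edge-↑ˡ-↑ˡ i k) ik))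
              , (λ j l jl → ind _ _ (trans (edge-↑ʳ-↑ʳ j l) jl))
              , ind _ _ (trans (edge-↑ˡ-↑ʳ r₁ r₂) (from (⌊≟⌋∧⌊≟⌋⇔ {i = r₁} {r₁} {r₂} {r₂}) (refl , refl)))
    join-parts : Independent A₁ f₁ × Independent A₂ f₂ × (toℕ (f₁ r₁) ≡ 0 ⊎ toℕ (f₂ r₂) ≡ 0) →
                 Independent T f
    join-parts (ind₁ , ind₂ , root-edge) =
      ↑-elim _ (λ i → ↑-elim _ (left-left i) (left-right i))
               (λ j → ↑-elim _ (right-left j) (right-right j))
      where
      left-left : ∀ i k → T (i ↑ˡ n₂) (k ↑ˡ n₂) ≡ true → _
      left-left i k ik = ind₁ i k (trans (sym (edge-↑ˡ-↑ˡ i k)) ik)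
      right-right : ∀ j l → T (n₁ ↑ʳ j) (n₁ ↑ʳ l) ≡ true → _
      right-right j l jl = ind₂ j l (trans (sym (edge-↑ʳ-↑ʳ j l)) jl)
      left-right : ∀ i j → T (i ↑ˡ n₂) (n₁ ↑ʳ j) ≡ true → _
      left-right i j ij with to (⌊≟⌋∧⌊≟⌋⇔ {i = i} {r₁} {j} {r₂}) (trans (sym (edge-↑ˡ-↑ʳ i j)) ij)
      ... | refl , refl = root-edge
      right-left : ∀ j i → T (n₁ ↑ʳ j) (i ↑ˡ n₂) ≡ true → _
      right-left j i ji with to (⌊≟⌋∧⌊≟⌋⇔ {i = i} {r₁} {j} {r₂}) (trans (sym (edge-↑ʳ-↑ˡ j i)) ji)
      ... | refl , refl = swap root-edge

  module _ (fr₁≡1 : toℕ (f₁ r₁) ≡ 1) where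

    dominated-↑ˡ : ∀ i → Dominated T f (i ↑ˡ n₂) ⇔ Dominated A₁ f₁ i
    dominated-↑ˡ i with i ≟ r₁ | nsum-↑ˡ i
    ... | yes refl | _ = mk⇔ (λ _ → ⊥-elim ∘ ≡1⇒≢0 fr₁≡1) (λ _ → ⊥-elim ∘ ≡1⇒≢0 fr₁≡1)
    ... | no _ | s≡ = →2≤-cong (trans s≡ (+-identityʳ _))

    dominated-↑ʳ-r₂ : Dominated T f (n₁ ↑ʳ r₂) ⇔ (toℕ (f₂ r₂) ≡ 0 → 1 ≤ nsum A₂ f₂ r₂)
    dominated-↑ʳ-r₂ with r₂ ≟ r₂ | nsum-↑ʳ r₂
    ... | yes _   | s≡ = ⇔.trans (→2≤-cong (trans s≡ (cong (_+ nsum A₂ f₂ r₂) fr₁≡1)))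
                                 (mk⇔ (s≤s⁻¹ ∘_) (s≤s ∘_))
    ... | no r₂≢r₂ | _ = ⊥-elim (r₂≢r₂ refl)

  dominated-↑ʳ : ∀ {j} → j ≢ r₂ → Dominated T f (n₁ ↑ʳ j) ⇔ Dominated A₂ f₂ j
  dominated-↑ʳ {j} j≢r₂ with j ≟ r₂ | nsum-↑ʳ j
  ... | yes j≡r₂ | _  = ⊥-elim (j≢r₂ j≡r₂)
  ... | no _     | s≡ = →2≤-cong s≡

  ClassB-compose : ClassB T f (r₁ ↑ˡ n₂) ⇔ (ClassB A₁ f₁ r₁ × HangsFromWeight1 A₂ f₂ r₂)
  ClassB-compose = mk⇔ decompose compose-parts
    where
    decompose : ClassB T f (r₁ ↑ˡ n₂) → ClassB A₁ f₁ r₁ × HangsFromWeight1 A₂ f₂ r₂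
    decompose (ir , fr₁≡1) with to IR2DF⇔ ir
    ... | dom , ind with to independent-compose ind
    ...   | ind₁ , ind₂ , root-edge =
      (from IR2DF⇔ ((λ i → to (dominated-↑ˡ fr₁≡1 i) (dom _)) , ind₁) , fr₁≡1) , record
        { root-zero    = fr₂≡0
        ; root-covered = to (dominated-↑ʳ-r₂ fr₁≡1) (dom _) fr₂≡0
        ; dominated    = λ j j≢r₂ → to (dominated-↑ʳ j≢r₂) (dom _)
        ; independent  = ind₂
        }
      where
      fr₂≡0 : toℕ (f₂ r₂) ≡ 0
      fr₂≡0 = fromInj₂ (⊥-elim ∘ ≡1⇒≢0 fr₁≡1) root-edge
    compose-parts : ClassB A₁ f₁ r₁ × HangsFromWeight1 A₂ f₂ r₂ → ClassB T f (r₁ ↑ˡ n₂)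
    compose-parts ((ir₁ , fr₁≡1) , h) with to IR2DF⇔ ir₁
    ... | dom₁ , ind₁ =
      from IR2DF⇔ (↑-elim _ dom-↑ˡ dom-↑ʳ , from independent-compose (ind₁ , independent , inj₂ root-zero))
      , fr₁≡1
      where
      open HangsFromWeight1 h
      dom-↑ˡ : ∀ i → Dominated T f (i ↑ˡ n₂)
      dom-↑ˡ i = from (dominated-↑ˡ fr₁≡1 i) (dom₁ i)
      dom-↑ʳ : ∀ j → Dominated T f (n₁ ↑ʳ j)
      dom-↑ʳ j with j ≟ r₂
      ... | yes refl = from (dominated-↑ʳ-r₂ fr₁≡1) (λ _ → root-covered)
      ... | no j≢r₂  = from (dominated-↑ʳ j≢r₂) (dominated j j≢r₂)

lemma3 : (n₁ n₂ : ℕ) (A₁ : Adj n₁) (A₂ : Adj n₂) (r₁ : Fin n₁) (r₂ : Fin n₂) →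
         IsTree A₁ → IsTree A₂ → (f : Lab (n₁ + n₂)) →
         ClassB (compose A₁ r₁ A₂ r₂) f (r₁ ↑ˡ n₂)
           ⇔ (ClassB A₁ (λ i → f (i ↑ˡ n₂)) r₁
              × (ClassC A₂ (λ j → f (n₁ ↑ʳ j)) r₂ ⊎ ClassD A₂ (λ j → f (n₁ ↑ʳ j)) r₂))
lemma3 n₁ n₂ A₁ A₂ r₁ r₂ _ (symmetric₂ , _) f =
  ⇔.trans (ClassB-compose A₁ r₁ A₂ r₂ f) (⇔.refl ×-⇔ ⇔.sym (ClassC⊎ClassD⇔HangsFromWeight1 symmetric₂))
  where open Composition
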